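{- Let $k\ge1$, $n\ge1$ and let $\Delta$ be an integer with $0\le\Delta\le n-1$. The number of valid $(n-1)$-tuples is at least the number of $[k-\Delta,k]$-restricted nonnegative walks of length $n-1-\Delta$.
   Context: For an array $A$ of distinct numbers and $j\ge1$, let $d_j(\ell)$ be the number of positions $\ell'\in(\ell,j]$ with $A[\ell']>A[\ell]$, and let $S_k(j)$ be the array of length $j$ with $S_k(j,\ell)=\min(d_j(\ell),k)$; its size is $|S_k(j)|=\sum_{\ell=1}^{j}(k-S_k(j,\ell))$. An $(n-1)$-tuple of nonnegative integers $(\delta_1,\dots,\delta_{n-1})$ is valid if there exists an array $A[1..n]$ of distinct integers such that $\delta_j=|S_k(j)|-|S_k(j+1)|+k$ for every $j=1,\dots,n-1$. For a set $Y$ of integers, a $Y$-restricted nonnegative walk of length $m$ is a walk in the plane starting at $(0,0)$ consisting of $m$ steps of the form $(1,a_i)$ with $a_i\in Y$, $i=1,\dots,m$, such that the $y$-coordinate of the current position is always nonnegative. $[a,b]$ denotes the set of integers from $a$ to $b$. -}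

module Defs where

open import Data.Nat using (ℕ; zero; suc; _∸_; _⊓_; _<?_; _≤_)
open import Data.Integer as ℤ using (ℤ; +_)
open import Data.List using (List; []; _∷_; map; upTo; filter; length)
open import Data.Nat.ListAction using (sum)
open import Data.Vec using (Vec; []; _∷_; lookup)
open import Data.Fin using (Fin; toℕ)
open import Data.Product using (Σ; _×_; ∃)
open import Data.Unit using (⊤)
open import Relation.Nullary.Decidable using (_×-dec_)
open import Relation.Binary.PropositionalEquality using (_≡_)

-- An array A[1..n] is modelled as a function A : ℕ → ℤ; only positions 1..n matter.
-- Positions 1..j
positions : ℕ → List ℕ
positions j = map suc (upTo j)

d : (ℕ → ℤ) → ℕ → ℕ → ℕ
d A j ℓ = length (filter (λ ℓ' → (ℓ <? ℓ') ×-dec (A ℓ ℤ.<? A ℓ')) (positions j))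

S : (ℕ → ℤ) → ℕ → ℕ → ℕ → ℕ
S A k j ℓ = d A j ℓ ⊓ k

size : (ℕ → ℤ) → ℕ → ℕ → ℕ
size A k j = sum (map (λ ℓ → k ∸ S A k j ℓ) (positions j))

Distinct : ℕ → (ℕ → ℤ) → Set
Distinct n A = ∀ i j → 1 ≤ i → i ≤ n → 1 ≤ j → j ≤ n → A i ≡ A j → i ≡ j

-- A tuple (δ_1,…,δ_{n-1}) of nonnegative integers is valid (for parameter k):
-- some array A[1..n] of distinct integers satisfies
-- δ_j = |S_k(j)| - |S_k(j+1)| + k for all j = 1..n-1.
-- (Fin index i corresponds to j = i + 1.)
Valid : (k n : ℕ) → Vec ℕ (n ∸ 1) → Set
Valid k n δs = Σ (ℕ → ℤ) λ A → Distinct n A ×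
  (∀ (i : Fin (n ∸ 1)) →
     + lookup δs i ≡ (+ size A k (suc (toℕ i)) ℤ.- + size A k (suc (suc (toℕ i)))) ℤ.+ + k)

StepsIn : ℤ → ℤ → {m : ℕ} → Vec ℤ m → Set
StepsIn lo hi [] = ⊤
StepsIn lo hi (a ∷ as) = (lo ℤ.≤ a × a ℤ.≤ hi) × StepsIn lo hi as

NonnegFrom : ℤ → {m : ℕ} → Vec ℤ m → Set
NonnegFrom h [] = ⊤
NonnegFrom h (a ∷ as) = (+ 0 ℤ.≤ h ℤ.+ a) × NonnegFrom (h ℤ.+ a) as

-- [lo, hi]-restricted nonnegative walk of length m, given by its step heights a_1..a_m
-- (walk starts at (0,0), steps (1, a_i)).
RestrictedWalk : ℤ → ℤ → ℕ → Set
RestrictedWalk lo hi m = Σ (Vec ℤ m) λ as → StepsIn lo hi as × NonnegFrom (+ 0) as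

module Submission where

-- The entries ℓ ≤ j that lose a unit of slack when A[j+1] arrives are exactly the active
-- ones (d_j(ℓ) < k) lying below A[j+1], so δ_j is the rank of A[j+1] among the active
-- entries, and |S_k(j+1)| = |S_k(j)| + k - δ_j.  Every rank up to the number of active
-- entries, which is at least |S_k(j)| / k, can be chosen; hence a tuple is valid as soon as
-- k δ_{j+1} + δ_1 + ... + δ_j ≤ k (j+1) for all j.  To choose ranks with entries that never
-- move, the entries placed before stage j are even multiples of 2^(n-j-1) and the new one is
-- an odd multiple, located by a discrete intermediate value argument.
-- A [k-Δ,k]-restricted nonnegative walk yields such a tuple: Δ zeros followed by the
-- deficits k - a_i, since each deficit is at most Δ and the first t of them sum to kt minus
-- the current height.  The walk is recovered from its deficits, so the map is injective.

open import Defs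
open import Data.Nat using (ℕ; _≤_; _∸_)
open import Data.Integer using (+_; _-_)
open import Data.Vec using (Vec)
open import Data.Product using (Σ; _×_; proj₁)
open import Relation.Binary.PropositionalEquality using (_≡_)

open import Data.Bool using (Bool; true; false; _∧_; if_then_else_)
open import Data.Bool.Properties using (∧-identityʳ; ∧-zeroʳ)
open import Data.Empty using (⊥-elim)
open import Data.Fin using (Fin; toℕ; fromℕ<)
open import Data.Fin.Properties using (toℕ<n; toℕ-fromℕ<)
open import Data.Integer as ℤ using (ℤ; ∣_∣)
import Data.Integer.Properties as ℤP
open import Data.Integer.Tactic.RingSolver using (solve-∀)
open import Data.List using ([_]; _++_; map; filter; length; upTo)
open import Data.List.Properties using (map-++; length-++; filter-++; upTo-∷ʳ)
open import Data.Nat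
  using (zero; suc; _+_; _*_; _^_; _⊓_; _<_; _≤?_; _<?_; _≟_; z≤n; s≤s; s≤s⁻¹; NonZero; >-nonZero)
open import Data.Nat.ListAction using (sum)
open import Data.Nat.ListAction.Properties using (sum-++)
open import Data.Nat.Properties
open import Algebra.Properties.CommutativeSemigroup +-commutativeSemigroup
  using ()
  renaming (interchange to +-interchange; x∙yz≈xz∙y to x+[y+z]≡[x+z]+y; xy∙z≈xz∙y to [x+y]+z≡[x+z]+y)
open import Data.Product using (∃; _,_; proj₂)
open import Data.Sum using (_⊎_; inj₁; inj₂)
open import Data.Vec using ([]; _∷_; tabulate; lookup)
open import Data.Vec.Properties using (lookup∘tabulate)
open import Function using (_∘_)
open import Relation.Nullary using (Dec; yes; no)
open import Relation.Nullary.Decidable using (isYes; _×-dec_)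
open import Relation.Binary.PropositionalEquality
  using (refl; sym; trans; cong; cong₂; subst; _≢_; module ≡-Reasoning)

∑ : ℕ → (ℕ → ℕ) → ℕ
∑ zero    f = 0
∑ (suc j) f = ∑ j f + f (suc j)

_∈[1,_] : ℕ → ℕ → Set
ℓ ∈[1, j ] = 1 ≤ ℓ × ℓ ≤ j

∈[1,]-weaken : ∀ {ℓ j} → ℓ ∈[1, j ] → ℓ ∈[1, suc j ]
∈[1,]-weaken (1≤ℓ , ℓ≤j) = 1≤ℓ , m≤n⇒m≤1+n ℓ≤j

∑-cong : ∀ j {f g} → (∀ ℓ → ℓ ∈[1, j ] → f ℓ ≡ g ℓ) → ∑ j f ≡ ∑ j g
∑-cong zero    f≗g = refl
∑-cong (suc j) f≗g =
  cong₂ _+_ (∑-cong j λ ℓ ℓ∈ → f≗g ℓ (∈[1,]-weaken ℓ∈)) (f≗g (suc j) (s≤s z≤n , ≤-refl))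

∑-mono-≤ : ∀ j {f g} → (∀ ℓ → ℓ ∈[1, j ] → f ℓ ≤ g ℓ) → ∑ j f ≤ ∑ j g
∑-mono-≤ zero    f≤g = z≤n
∑-mono-≤ (suc j) f≤g =
  +-mono-≤ (∑-mono-≤ j λ ℓ ℓ∈ → f≤g ℓ (∈[1,]-weaken ℓ∈)) (f≤g (suc j) (s≤s z≤n , ≤-refl))

∑-zero : ∀ j {f} → (∀ ℓ → ℓ ∈[1, j ] → f ℓ ≡ 0) → ∑ j f ≡ 0
∑-zero zero    f≗0 = refl
∑-zero (suc j) f≗0 =
  cong₂ _+_ (∑-zero j λ ℓ ℓ∈ → f≗0 ℓ (∈[1,]-weaken ℓ∈)) (f≗0 (suc j) (s≤s z≤n , ≤-refl))

∑-distrib-+ : ∀ j f g → ∑ j (λ ℓ → f ℓ + g ℓ) ≡ ∑ j f + ∑ j g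
∑-distrib-+ zero    f g = refl
∑-distrib-+ (suc j) f g rewrite ∑-distrib-+ j f g = +-interchange (∑ j f) (∑ j g) (f (suc j)) (g (suc j))

∑-*ˡ : ∀ j k f → ∑ j (λ ℓ → k * f ℓ) ≡ k * ∑ j f
∑-*ˡ zero    k f = sym (*-zeroʳ k)
∑-*ˡ (suc j) k f rewrite ∑-*ˡ j k f = sym (*-distribˡ-+ k (∑ j f) (f (suc j)))

∈[1,suc]-split : ∀ {ℓ j} → ℓ ∈[1, suc j ] → ℓ ∈[1, j ] ⊎ ℓ ≡ suc j
∈[1,suc]-split (1≤ℓ , ℓ≤1+j) with m≤n⇒m<n∨m≡n ℓ≤1+j
... | inj₁ ℓ<1+j = inj₁ (1≤ℓ , s≤s⁻¹ ℓ<1+j)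
... | inj₂ ℓ≡1+j = inj₂ ℓ≡1+j

∑-term-≤ : ∀ j f {ℓ} → ℓ ∈[1, j ] → f ℓ ≤ ∑ j f
∑-term-≤ zero    f (1≤ℓ , ℓ≤0) = ⊥-elim (<-irrefl refl (≤-trans 1≤ℓ ℓ≤0))
∑-term-≤ (suc j) f ℓ∈ with ∈[1,suc]-split ℓ∈
... | inj₁ ℓ∈′ = ≤-trans (∑-term-≤ j f ℓ∈′) (m≤m+n _ _)
... | inj₂ refl = m≤n+m _ _

∑-shiftˡ : ∀ t f → ∑ (suc t) f ≡ f 1 + ∑ t (λ i → f (suc i))
∑-shiftˡ zero    f = +-comm 0 (f 1)
∑-shiftˡ (suc t) f rewrite ∑-shiftˡ t f = +-assoc (f 1) _ _

∑-delay : ∀ Δ e → e 0 ≡ 0 → ∀ j → ∑ j (λ i → e (i ∸ Δ)) ≡ ∑ (j ∸ Δ) e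
∑-delay Δ e e0≡0 zero = sym (cong (λ m → ∑ m e) (0∸n≡0 Δ))
∑-delay Δ e e0≡0 (suc j) with Δ ≤? j
... | yes Δ≤j rewrite ∑-delay Δ e e0≡0 j | +-∸-assoc 1 Δ≤j = refl
... | no  Δ≰j rewrite ∑-delay Δ e e0≡0 j | m≤n⇒m∸n≡0 (≰⇒> Δ≰j) | m≤n⇒m∸n≡0 (<⇒≤ (≰⇒> Δ≰j)) = e0≡0

bit : Bool → ℕ
bit true  = 1
bit false = 0

count : ℕ → (ℕ → Bool) → ℕ
count j p = ∑ j (λ ℓ → bit (p ℓ))

count-≤1 : ∀ j p → (∀ {a b} → a ∈[1, j ] → b ∈[1, j ] → p a ≡ true → p b ≡ true → a ≡ b) →
           count j p ≤ 1
count-≤1 zero    p unique = z≤n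
count-≤1 (suc j) p unique with p (suc j) in p[1+j]
... | false = +-monoˡ-≤ 0 (count-≤1 j p λ a∈ b∈ → unique (∈[1,]-weaken a∈) (∈[1,]-weaken b∈))
... | true  = ≤-reflexive (cong (_+ 1) (∑-zero j none))
  where
  none : ∀ ℓ → ℓ ∈[1, j ] → bit (p ℓ) ≡ 0
  none ℓ ℓ∈ with p ℓ in pℓ
  ... | false = refl
  ... | true  = ⊥-elim (<-irrefl (unique (∈[1,]-weaken ℓ∈) (s≤s z≤n , ≤-refl) pℓ p[1+j]) (s≤s (proj₂ ℓ∈)))

positions-suc : ∀ j → positions (suc j) ≡ positions j ++ [ suc j ]
positions-suc j = trans (cong (map suc) (sym (upTo-∷ʳ j))) (map-++ suc (upTo j) [ j ])

sum-positions : ∀ f j → sum (map f (positions j)) ≡ ∑ j f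
sum-positions f zero    = refl
sum-positions f (suc j) = begin
  sum (map f (positions (suc j)))          ≡⟨ cong (sum ∘ map f) (positions-suc j) ⟩
  sum (map f (positions j ++ [ suc j ]))   ≡⟨ cong sum (map-++ f (positions j) [ suc j ]) ⟩
  sum (map f (positions j) ++ [ f (suc j) ]) ≡⟨ sum-++ (map f (positions j)) [ f (suc j) ] ⟩
  sum (map f (positions j)) + (f (suc j) + 0) ≡⟨ cong₂ _+_ (sum-positions f j) (+-identityʳ _) ⟩
  ∑ (suc j) f                              ∎
  where open ≡-Reasoning

length-filter-positions : ∀ {P : ℕ → Set} (P? : ∀ x → Dec (P x)) j →
                          length (filter P? (positions j)) ≡ count j (isYes ∘ P?)
length-filter-positions P? zero    = refl
length-filter-positions P? (suc j) = begin
  length (filter P? (positions (suc j)))                   ≡⟨ cong (length ∘ filter P?) (positions-suc j) ⟩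
  length (filter P? (positions j ++ [ suc j ]))            ≡⟨ cong length (filter-++ P? (positions j) [ suc j ]) ⟩
  length (filter P? (positions j) ++ filter P? [ suc j ])  ≡⟨ length-++ (filter P? (positions j)) ⟩
  length (filter P? (positions j)) + length (filter P? [ suc j ])
    ≡⟨ cong₂ _+_ (length-filter-positions P? j) (length-filter-singleton (suc j)) ⟩
  count (suc j) (isYes ∘ P?)                               ∎
  where
  open ≡-Reasoning
  length-filter-singleton : ∀ x → length (filter P? [ x ]) ≡ bit (isYes (P? x))
  length-filter-singleton x with P? x
  ... | yes _ = refl
  ... | no  _ = refl

module _ (A : ℕ → ℤ) where

  laterAndLarger : ℕ → ℕ → Bool
  laterAndLarger ℓ ℓ′ = isYes ((ℓ <? ℓ′) ×-dec (A ℓ ℤ.<? A ℓ′))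

  d-count : ∀ j ℓ → d A j ℓ ≡ count j (laterAndLarger ℓ)
  d-count j ℓ = length-filter-positions (λ ℓ′ → (ℓ <? ℓ′) ×-dec (A ℓ ℤ.<? A ℓ′)) j

  d-self : ∀ j → d A j j ≡ 0
  d-self j = trans (d-count j j) (∑-zero j later-only)
    where
    later-only : ∀ ℓ′ → ℓ′ ∈[1, j ] → bit (laterAndLarger j ℓ′) ≡ 0
    later-only ℓ′ (_ , ℓ′≤j) with j <? ℓ′
    ... | yes j<ℓ′ = ⊥-elim (<-irrefl refl (<-≤-trans j<ℓ′ ℓ′≤j))
    ... | no  _    = refl

  d-suc : ∀ j ℓ → ℓ ≤ j → d A (suc j) ℓ ≡ d A j ℓ + bit (isYes (A ℓ ℤ.<? A (suc j)))
  d-suc j ℓ ℓ≤j rewrite d-count (suc j) ℓ | d-count j ℓ with ℓ <? suc j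
  ... | no  ℓ≮ = ⊥-elim (ℓ≮ (s≤s ℓ≤j))
  ... | yes _ with A ℓ ℤ.<? A (suc j)
  ...   | yes _ = refl
  ...   | no  _ = refl

  active : ℕ → ℕ → ℕ → Bool
  active k j ℓ = isYes (d A j ℓ <? k)

  activeBelow : ℕ → ℕ → ℤ → ℕ
  activeBelow k j v = count j (λ ℓ → active k j ℓ ∧ isYes (A ℓ ℤ.<? v))

slack : ℕ → ℕ → ℕ
slack k x = k ∸ (x ⊓ k)

slack-step : ∀ k x b → slack k (x + bit b) + bit (isYes (x <? k) ∧ b) ≡ slack k x
slack-step k x false rewrite ∧-zeroʳ (isYes (x <? k)) | +-identityʳ x = +-identityʳ (slack k x)
slack-step zero    x true rewrite ⊓-zeroʳ (x + 1) | ⊓-zeroʳ x = refl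
slack-step (suc k) x true rewrite +-comm x 1 with x <? suc k
... | yes (s≤s x≤k) rewrite m≤n⇒m⊓n≡m x≤k | m≤n⇒m⊓n≡m (m≤n⇒m≤1+n x≤k) =
  trans (+-comm (k ∸ x) 1) (sym (+-∸-assoc 1 x≤k))
... | no  x≮ rewrite m≥n⇒m⊓n≡n (≤-trans (n≤1+n k) (≮⇒≥ x≮)) | m≥n⇒m⊓n≡n (≮⇒≥ x≮) = +-identityʳ _

module _ (A : ℕ → ℤ) (k : ℕ) where

  size-∑ : ∀ j → size A k j ≡ ∑ j (slack k ∘ d A j)
  size-∑ j = sum-positions (slack k ∘ d A j) j

  size-suc : ∀ j → size A k (suc j) + activeBelow A k j (A (suc j)) ≡ size A k j + k
  size-suc j = begin
    size A k (suc j) + ∑ j raised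
      ≡⟨ cong (_+ ∑ j raised) (size-∑ (suc j)) ⟩
    ∑ j after + slack k (d A (suc j) (suc j)) + ∑ j raised
      ≡⟨ cong (λ x → ∑ j after + slack k x + ∑ j raised) (d-self A (suc j)) ⟩
    ∑ j after + k + ∑ j raised
      ≡⟨ [x+y]+z≡[x+z]+y (∑ j after) k (∑ j raised) ⟩
    ∑ j after + ∑ j raised + k
      ≡⟨ cong (_+ k) (∑-distrib-+ j after raised) ⟨
    ∑ j (λ ℓ → after ℓ + raised ℓ) + k
      ≡⟨ cong (_+ k) (∑-cong j λ ℓ (_ , ℓ≤j) →
           trans (cong (λ x → slack k x + raised ℓ) (d-suc A j ℓ ℓ≤j))
                 (slack-step k (d A j ℓ) (isYes (A ℓ ℤ.<? A (suc j))))) ⟩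
    ∑ j (slack k ∘ d A j) + k
      ≡⟨ cong (_+ k) (size-∑ j) ⟨
    size A k j + k ∎
    where
    open ≡-Reasoning
    after = slack k ∘ d A (suc j)
    raised : ℕ → ℕ
    raised ℓ = bit (active A k j ℓ ∧ isYes (A ℓ ℤ.<? A (suc j)))

  size-≤-k*active : ∀ j → size A k j ≤ k * count j (active A k j)
  size-≤-k*active j rewrite size-∑ j | sym (∑-*ˡ j k (bit ∘ active A k j)) = ∑-mono-≤ j slack-≤
    where
    slack-≤ : ∀ ℓ → ℓ ∈[1, j ] → slack k (d A j ℓ) ≤ k * bit (active A k j ℓ)
    slack-≤ ℓ _ with d A j ℓ <? k
    ... | yes _ = subst (slack k (d A j ℓ) ≤_) (sym (*-identityʳ k)) (m∸n≤m k (d A j ℓ ⊓ k))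
    ... | no  ≮ rewrite m≥n⇒m⊓n≡n (≮⇒≥ ≮) | n∸n≡0 k = z≤n

Agree : ℕ → (ℕ → ℤ) → (ℕ → ℤ) → Set
Agree j A B = ∀ ℓ → ℓ ∈[1, j ] → A ℓ ≡ B ℓ

module _ {j A B} (A≗B : Agree j A B) where

  d-cong : ∀ {ℓ} → ℓ ∈[1, j ] → d A j ℓ ≡ d B j ℓ
  d-cong {ℓ} ℓ∈ rewrite d-count A j ℓ | d-count B j ℓ =
    ∑-cong j λ ℓ′ ℓ′∈ → cong₂ (λ x y → bit (isYes ((ℓ <? ℓ′) ×-dec (x ℤ.<? y)))) (A≗B ℓ ℓ∈) (A≗B ℓ′ ℓ′∈)

  size-cong : ∀ k → size A k j ≡ size B k j
  size-cong k rewrite size-∑ A k j | size-∑ B k j = ∑-cong j λ ℓ ℓ∈ → cong (slack k) (d-cong ℓ∈)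

  activeBelow-cong : ∀ k v → activeBelow A k j v ≡ activeBelow B k j v
  activeBelow-cong k v = ∑-cong j λ ℓ ℓ∈ →
    cong₂ (λ x y → bit (isYes (x <? k) ∧ isYes (y ℤ.<? v))) (d-cong ℓ∈) (A≗B ℓ ℓ∈)

crossing : (ℕ → ℕ) → ℕ → ℕ → ℕ
crossing g e zero    = 0
crossing g e (suc N) with e ≤? g N
... | yes _ = crossing g e N
... | no  _ = suc N

crossing-hits : ∀ (g : ℕ → ℕ) e → (∀ u → g (suc u) ≤ suc (g u)) → g 0 ≤ e →
                ∀ (N : ℕ) → e ≤ g N → g (crossing g e N) ≡ e
crossing-hits g e unit g0≤e zero    e≤gN = ≤-antisym g0≤e e≤gN
crossing-hits g e unit g0≤e (suc N) e≤gN with e ≤? g N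
... | yes e≤g = crossing-hits g e unit g0≤e N e≤g
... | no  e≰g = ≤-antisym (≤-trans (unit N) (≰⇒> e≰g)) e≤gN

1+2*u≤2*q⇒u<q : ∀ {u q} → suc (2 * u) ≤ 2 * q → u < q
1+2*u≤2*q⇒u<q {u} {q} = *-cancelˡ-< 2 u q

2*q≤1+2*u⇒q≤u : ∀ {q u} → 2 * q ≤ suc (2 * u) → q ≤ u
2*q≤1+2*u⇒q≤u {q} {u} le = s≤s⁻¹ (*-cancelˡ-< 2 q (suc u) (subst (2 * q <_) (sym (*-suc 2 u)) (s≤s le)))

2*q≢1+2*u : ∀ q u → 2 * q ≢ suc (2 * u)
2*q≢1+2*u q u eq = <⇒≱ (1+2*u≤2*q⇒u<q {u} {q} (≤-reflexive (sym eq))) (2*q≤1+2*u⇒q≤u (≤-reflexive eq))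

2^[n∸j]≡2*2^[n∸1+j] : ∀ {n j} → j < n → 2 ^ (n ∸ j) ≡ 2 * 2 ^ (n ∸ suc j)
2^[n∸j]≡2*2^[n∸1+j] {suc n} {j} (s≤s j≤n) = cong (2 ^_) (+-∸-assoc 1 j≤n)

PrefixBounded : ℕ → ℕ → (ℕ → ℕ) → Set
PrefixBounded k n E = ∀ j → suc j < n → k * E (suc j) + ∑ j E ≤ k * suc j

module Insertion (n k : ℕ) (E : ℕ → ℕ) where

  scale : ℕ → ℕ
  scale j = 2 ^ (n ∸ suc j)

  instance
    scale-nonZero : ∀ {j} → NonZero (scale j)
    scale-nonZero {j} = m^n≢0 2 (n ∸ suc j)

  slot : ℕ → ℕ → ℕ
  slot j u = scale j * suc (2 * u)

  -- array j is the array after j insertions; its entries beyond position j are junk.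
  mutual
    array : ℕ → ℕ → ℕ
    array zero    _ = 0
    array (suc j) p = if isYes (p ≤? j) then array j p else slot j (choice j)

    stage : ℕ → ℕ → ℤ
    stage j = +_ ∘ array j

    below : ℕ → ℕ → ℕ
    below j u = activeBelow (stage j) k j (+ slot j u)

    choice : ℕ → ℕ
    choice j = crossing (below j) (E j) (∑ j (array j))

  array-old : ∀ {j p} → p ≤ j → array (suc j) p ≡ array j p
  array-old {j} {p} p≤j with p ≤? j
  ... | yes _   = refl
  ... | no  p≰j = ⊥-elim (p≰j p≤j)

  array-new : ∀ j → array (suc j) (suc j) ≡ slot j (choice j)
  array-new j with suc j ≤? j
  ... | yes 1+j≤j = ⊥-elim (<-irrefl refl 1+j≤j)
  ... | no  _     = refl

  array-settled : ∀ i {j p} → p ≤ j → array (i + j) p ≡ array j p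
  array-settled zero    p≤j = refl
  array-settled (suc i) p≤j = trans (array-old (≤-trans p≤j (m≤n+m _ i))) (array-settled i p≤j)

  stage-old : ∀ j → Agree j (stage (suc j)) (stage j)
  stage-old j ℓ (_ , ℓ≤j) = cong +_ (array-old ℓ≤j)

  scale-suc : ∀ {j} → suc j < n → ∀ x → scale j * x ≡ scale (suc j) * (2 * x)
  scale-suc {j} 1+j<n x = begin
    scale j * x                ≡⟨ cong (_* x) (2^[n∸j]≡2*2^[n∸1+j] 1+j<n) ⟩
    2 * scale (suc j) * x      ≡⟨ cong (_* x) (*-comm 2 (scale (suc j))) ⟩
    scale (suc j) * 2 * x      ≡⟨ *-assoc (scale (suc j)) 2 x ⟩
    scale (suc j) * (2 * x)    ∎
    where open ≡-Reasoning

  OnGrid : ℕ → ℕ → Set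
  OnGrid j v = ∃ λ q → 1 ≤ q × v ≡ scale j * (2 * q)

  array-onGrid : ∀ {j ℓ} → j < n → ℓ ∈[1, j ] → OnGrid j (array j ℓ)
  array-onGrid {zero}  _     (1≤ℓ , ℓ≤0) = ⊥-elim (<-irrefl refl (≤-trans 1≤ℓ ℓ≤0))
  array-onGrid {suc j} 1+j<n ℓ∈ with ∈[1,suc]-split ℓ∈
  ... | inj₂ refl = suc (2 * choice j) , s≤s z≤n ,
                    trans (array-new j) (scale-suc 1+j<n (suc (2 * choice j)))
  ... | inj₁ ℓ∈′@(_ , ℓ≤j) with array-onGrid (<-trans (n<1+n j) 1+j<n) ℓ∈′
  ...   | q , 1≤q , on-grid = 2 * q , ≤-trans 1≤q (m≤n*m q 2) ,
                              trans (array-old ℓ≤j) (trans on-grid (scale-suc 1+j<n (2 * q)))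

  slot≢grid : ∀ j u q → slot j u ≢ scale j * (2 * q)
  slot≢grid j u q eq = 2*q≢1+2*u q u (*-cancelˡ-≡ (2 * q) (suc (2 * u)) (scale j) (sym eq))

  array-old≢new : ∀ {j ℓ} → j < n → ℓ ∈[1, j ] → array (suc j) ℓ ≢ array (suc j) (suc j)
  array-old≢new {j} j<n ℓ∈ eq with array-onGrid j<n ℓ∈
  ... | q , _ , on-grid = slot≢grid j (choice j) q
        (trans (sym (array-new j)) (trans (sym eq) (trans (array-old (proj₂ ℓ∈)) on-grid)))

  array-injective : ∀ {j a b} → j ≤ n → a ∈[1, j ] → b ∈[1, j ] → array j a ≡ array j b → a ≡ b
  array-injective {zero} _ (1≤a , a≤0) _ _ = ⊥-elim (<-irrefl refl (≤-trans 1≤a a≤0))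
  array-injective {suc j} 1+j≤n a∈ b∈ eq with ∈[1,suc]-split a∈ | ∈[1,suc]-split b∈
  ... | inj₂ refl | inj₂ refl = refl
  ... | inj₁ a∈′  | inj₁ b∈′  = array-injective (<⇒≤ 1+j≤n) a∈′ b∈′
                                  (trans (sym (array-old (proj₂ a∈′))) (trans eq (array-old (proj₂ b∈′))))
  ... | inj₁ a∈′  | inj₂ refl = ⊥-elim (array-old≢new 1+j≤n a∈′ eq)
  ... | inj₂ refl | inj₁ b∈′  = ⊥-elim (array-old≢new 1+j≤n b∈′ (sym eq))

  grid-between-slots : ∀ {j u q} → slot j u ≤ scale j * (2 * q) → scale j * (2 * q) < slot j (suc u) →
                       q ≡ suc u
  grid-between-slots {j} {u} {q} lo hi = ≤-antisym
    (*-cancelˡ-≤ 2 (s≤s⁻¹ (*-cancelˡ-< (scale j) (2 * q) (suc (2 * suc u)) hi)))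
    (1+2*u≤2*q⇒u<q (*-cancelˡ-≤ (scale j) lo))

  below-zero : ∀ {j} → j < n → below j 0 ≡ 0
  below-zero {j} j<n = ∑-zero j none
    where
    none : ∀ ℓ → ℓ ∈[1, j ] → bit (active (stage j) k j ℓ ∧ isYes (+ array j ℓ ℤ.<? + slot j 0)) ≡ 0
    none ℓ ℓ∈ with array j ℓ <? slot j 0 | array-onGrid j<n ℓ∈
    ... | no  _  | _              = cong bit (∧-zeroʳ _)
    ... | yes lt | q , 1≤q , on-grid =
      ⊥-elim (<⇒≱ (*-cancelˡ-< (scale j) (2 * q) 1 (subst (_< slot j 0) on-grid lt)) (≤-trans 1≤q (m≤n*m q 2)))

  below-unit : ∀ {j} → j < n → ∀ u → below j (suc u) ≤ suc (below j u)
  below-unit {j} j<n u = begin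
    below j (suc u)                                             ≤⟨ ∑-mono-≤ j pointwise ⟩
    ∑ j (λ ℓ → bit (counted ℓ u) + bit (isYes (array j ℓ ≟ c)))  ≡⟨ ∑-distrib-+ j _ _ ⟩
    below j u + count j (λ ℓ → isYes (array j ℓ ≟ c))           ≤⟨ +-monoʳ-≤ (below j u) (count-≤1 j _ hits-once) ⟩
    below j u + 1                                               ≡⟨ +-comm (below j u) 1 ⟩
    suc (below j u)                                             ∎
    where
    open ≤-Reasoning
    c = scale j * (2 * suc u)
    counted : ℕ → ℕ → Bool
    counted ℓ v = active (stage j) k j ℓ ∧ isYes (+ array j ℓ ℤ.<? + slot j v)
    hits-once : ∀ {a b} → a ∈[1, j ] → b ∈[1, j ] →
                isYes (array j a ≟ c) ≡ true → isYes (array j b ≟ c) ≡ true → a ≡ b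
    hits-once {a} {b} a∈ b∈ _ _ with array j a ≟ c | array j b ≟ c
    ... | yes a≡c | yes b≡c = array-injective (<⇒≤ j<n) a∈ b∈ (trans a≡c (sym b≡c))
    -- Only the grid point just above slot j u can enter the count when u grows by one.
    pointwise : ∀ ℓ → ℓ ∈[1, j ] →
                bit (counted ℓ (suc u)) ≤ bit (counted ℓ u) + bit (isYes (array j ℓ ≟ c))
    pointwise ℓ ℓ∈ with active (stage j) k j ℓ | array j ℓ <? slot j (suc u)
    ... | false | _     = z≤n
    ... | true  | no _  = z≤n
    ... | true  | yes hi with array j ℓ <? slot j u
    ...   | yes _  = s≤s z≤n
    ...   | no  lo with array j ℓ ≟ c | array-onGrid j<n ℓ∈
    ...     | yes _   | _ = s≤s z≤n
    ...     | no  ≢c  | q , _ , on-grid = ⊥-elim (≢c (trans on-grid (cong (λ r → scale j * (2 * r)) q≡1+u)))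
      where
      q≡1+u : q ≡ suc u
      q≡1+u = grid-between-slots {j} {u} {q}
        (subst (slot j u ≤_) on-grid (≮⇒≥ lo)) (subst (_< slot j (suc u)) on-grid hi)

  below-top : ∀ j → below j (∑ j (array j)) ≡ count j (active (stage j) k j)
  below-top j = ∑-cong j all-below
    where
    N = ∑ j (array j)
    all-below : ∀ ℓ → ℓ ∈[1, j ] →
                bit (active (stage j) k j ℓ ∧ isYes (+ array j ℓ ℤ.<? + slot j N)) ≡ bit (active (stage j) k j ℓ)
    all-below ℓ ℓ∈ with array j ℓ <? slot j N
    ... | yes _ = cong bit (∧-identityʳ _)
    ... | no  ≮ = ⊥-elim (≮ (begin-strict
      array j ℓ        ≤⟨ ∑-term-≤ j (array j) ℓ∈ ⟩
      N                <⟨ s≤s (m≤n*m N 2) ⟩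
      suc (2 * N)      ≤⟨ m≤n*m (suc (2 * N)) (scale j) ⟩
      slot j N         ∎))
      where open ≤-Reasoning

  stageSize : ℕ → ℕ
  stageSize j = size (stage j) k j

  below-choice : ∀ {j} .{{_ : NonZero k}} → j < n → k * E j ≤ stageSize j → below j (choice j) ≡ E j
  below-choice {j} j<n room = crossing-hits (below j) (E j) (below-unit j<n)
    (subst (_≤ E j) (sym (below-zero j<n)) z≤n) (∑ j (array j))
    (subst (E j ≤_) (sym (below-top j)) (*-cancelˡ-≤ k (≤-trans room (size-≤-k*active (stage j) k j))))

  stage-step : ∀ {j} .{{_ : NonZero k}} → j < n → k * E j ≤ stageSize j →
               stageSize (suc j) + E j ≡ stageSize j + k
  stage-step {j} j<n room = begin
    stageSize (suc j) + E j
      ≡⟨ cong (λ x → stageSize (suc j) + x) new-entry-raises ⟨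
    size (stage (suc j)) k (suc j) + activeBelow (stage (suc j)) k j (stage (suc j) (suc j))
      ≡⟨ size-suc (stage (suc j)) k j ⟩
    size (stage (suc j)) k j + k
      ≡⟨ cong (_+ k) (size-cong (stage-old j) k) ⟩
    stageSize j + k ∎
    where
    open ≡-Reasoning
    new-entry-raises : activeBelow (stage (suc j)) k j (stage (suc j) (suc j)) ≡ E j
    new-entry-raises = begin
      activeBelow (stage (suc j)) k j (+ array (suc j) (suc j))
        ≡⟨ cong (activeBelow (stage (suc j)) k j ∘ +_) (array-new j) ⟩
      activeBelow (stage (suc j)) k j (+ slot j (choice j))
        ≡⟨ activeBelow-cong (stage-old j) k _ ⟩
      below j (choice j)
        ≡⟨ below-choice j<n room ⟩
      E j ∎

  module _ .{{_ : NonZero k}} (bounded : PrefixBounded k n E) where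

    room : ∀ j → suc j < n → k * E (suc j) ≤ stageSize (suc j)

    stageSize-closed : ∀ j → suc j ≤ n → stageSize (suc j) + ∑ j E ≡ k * suc j
    stageSize-closed zero    _     = trans (size-suc (stage 1) k 0) (sym (*-identityʳ k))
    stageSize-closed (suc j) 2+j≤n = begin
      stageSize (2 + j) + (∑ j E + E (suc j))  ≡⟨ x+[y+z]≡[x+z]+y (stageSize (2 + j)) (∑ j E) (E (suc j)) ⟩
      stageSize (2 + j) + E (suc j) + ∑ j E    ≡⟨ cong (_+ ∑ j E) (stage-step 2+j≤n (room j 2+j≤n)) ⟩
      stageSize (suc j) + k + ∑ j E            ≡⟨ [x+y]+z≡[x+z]+y (stageSize (suc j)) k (∑ j E) ⟩
      stageSize (suc j) + ∑ j E + k            ≡⟨ cong (_+ k) (stageSize-closed j (<⇒≤ 2+j≤n)) ⟩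
      k * suc j + k                            ≡⟨ +-comm (k * suc j) k ⟩
      k + k * suc j                            ≡⟨ *-suc k (suc j) ⟨
      k * suc (suc j)                          ∎
      where open ≡-Reasoning

    room j 1+j<n = +-cancelʳ-≤ (∑ j E) (k * E (suc j)) (stageSize (suc j))
      (subst (k * E (suc j) + ∑ j E ≤_) (sym (stageSize-closed j (<⇒≤ 1+j<n))) (bounded j 1+j<n))

pos-difference : ∀ {a b e k} → b + e ≡ a + k → + e ≡ (+ a - + b) ℤ.+ + k
pos-difference {a} {b} {e} {k} b+e≡a+k = begin
  + e                   ≡⟨ [x+y]-x≡y (+ b) (+ e) ⟨
  (+ b ℤ.+ + e) - + b   ≡⟨ cong (_- + b) (ℤP.pos-+ b e) ⟨
  + (b + e) - + b       ≡⟨ cong (λ x → + x - + b) b+e≡a+k ⟩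
  + (a + k) - + b       ≡⟨ cong (_- + b) (ℤP.pos-+ a k) ⟩
  (+ a ℤ.+ + k) - + b   ≡⟨ [x+z]-y≡[x-y]+z (+ a) (+ b) (+ k) ⟩
  (+ a - + b) ℤ.+ + k   ∎
  where
  open ≡-Reasoning
  [x+y]-x≡y : ∀ x y → (x ℤ.+ y) - x ≡ y
  [x+y]-x≡y = solve-∀
  [x+z]-y≡[x-y]+z : ∀ x y z → (x ℤ.+ z) - y ≡ (x - y) ℤ.+ z
  [x+z]-y≡[x-y]+z = solve-∀

prefixBounded⇒valid : ∀ k n E .{{_ : NonZero k}} → PrefixBounded k n E →
                      Valid k n (tabulate (λ i → E (suc (toℕ i))))
prefixBounded⇒valid k n E bounded = A , distinct , δ-relation
  where
  open Insertion n k E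
  A = stage n

  A-settled : ∀ {j} → j ≤ n → Agree j A (stage j)
  A-settled {j} j≤n ℓ (_ , ℓ≤j) =
    cong +_ (trans (cong (λ m → array m ℓ) (sym (m∸n+n≡m j≤n))) (array-settled (n ∸ j) ℓ≤j))

  distinct : Distinct n A
  distinct a b 1≤a a≤n 1≤b b≤n eq = array-injective ≤-refl (1≤a , a≤n) (1≤b , b≤n) (ℤP.+-injective eq)

  size-step : ∀ j → suc (suc j) ≤ n → size A k (suc (suc j)) + E (suc j) ≡ size A k (suc j) + k
  size-step j 2+j≤n = begin
    size A k (2 + j) + E (suc j)  ≡⟨ cong (_+ E (suc j)) (size-cong (A-settled 2+j≤n) k) ⟩
    stageSize (2 + j) + E (suc j) ≡⟨ stage-step 2+j≤n (room bounded j 2+j≤n) ⟩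
    stageSize (suc j) + k         ≡⟨ cong (_+ k) (size-cong (A-settled (<⇒≤ 2+j≤n)) k) ⟨
    size A k (suc j) + k          ∎
    where open ≡-Reasoning

  δ-relation : ∀ (i : Fin (n ∸ 1)) → + lookup (tabulate (λ i → E (suc (toℕ i)))) i ≡
               (+ size A k (suc (toℕ i)) - + size A k (suc (suc (toℕ i)))) ℤ.+ + k
  δ-relation i rewrite lookup∘tabulate (λ i → E (suc (toℕ i))) i =
    pos-difference (size-step (toℕ i) (pred-cancel-< (toℕ<n i)))

x-[x-y]≡y : ∀ x y → x - (x - y) ≡ y
x-[x-y]≡y = solve-∀

module _ (k Δ : ℕ) where

  deficit : ℤ → ℕ
  deficit a = ∣ + k - a ∣

  -- Indexed from 1, and 0 at index 0 and beyond the last step.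
  deficits : ∀ {m} → Vec ℤ m → ℕ → ℕ
  deficits _        zero          = 0
  deficits []       (suc _)       = 0
  deficits (a ∷ _)  (suc zero)    = deficit a
  deficits (_ ∷ as) (suc (suc t)) = deficits as (suc t)

  StepsIn[k-Δ,k] : ∀ {m} → Vec ℤ m → Set
  StepsIn[k-Δ,k] = StepsIn (+ k - + Δ) (+ k)

  +deficit : ∀ {a} → a ℤ.≤ + k → + deficit a ≡ + k - a
  +deficit a≤k = ℤP.0≤i⇒+∣i∣≡i (ℤP.i≤j⇒0≤j-i a≤k)

  deficit-≤ : ∀ {a} → + k - + Δ ℤ.≤ a → a ℤ.≤ + k → deficit a ≤ Δ
  deficit-≤ {a} lo≤a a≤k = ℤP.drop‿+≤+ (begin
    + deficit a             ≡⟨ +deficit a≤k ⟩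
    + k - a                 ≤⟨ ℤP.+-monoʳ-≤ (+ k) (ℤP.neg-mono-≤ lo≤a) ⟩
    + k - (+ k - + Δ)       ≡⟨ x-[x-y]≡y (+ k) (+ Δ) ⟩
    + Δ                     ∎)
    where
    open ℤP.≤-Reasoning

  deficit-injective : ∀ {a b} → a ℤ.≤ + k → b ℤ.≤ + k → deficit a ≡ deficit b → a ≡ b
  deficit-injective {a} {b} a≤k b≤k eq = begin
    a                 ≡⟨ x-[x-y]≡y (+ k) a ⟨
    + k - (+ k - a)   ≡⟨ cong (λ x → + k - x) (trans (sym (+deficit a≤k)) (trans (cong +_ eq) (+deficit b≤k))) ⟩
    + k - (+ k - b)   ≡⟨ x-[x-y]≡y (+ k) b ⟩
    b                 ∎
    where
    open ≡-Reasoning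

  height+deficit : ∀ {h a} → ℤ.0ℤ ℤ.≤ + h ℤ.+ a → a ℤ.≤ + k → ∣ + h ℤ.+ a ∣ + deficit a ≡ h + k
  height+deficit {h} {a} 0≤h+a a≤k = ℤP.+-injective (begin
    + (∣ + h ℤ.+ a ∣ + deficit a)     ≡⟨ ℤP.pos-+ ∣ + h ℤ.+ a ∣ (deficit a) ⟩
    + ∣ + h ℤ.+ a ∣ ℤ.+ + deficit a   ≡⟨ cong₂ ℤ._+_ (ℤP.0≤i⇒+∣i∣≡i 0≤h+a) (+deficit a≤k) ⟩
    (+ h ℤ.+ a) ℤ.+ (+ k - a)         ≡⟨ [x+y]+[z-y]≡x+z (+ h) a (+ k) ⟩
    + h ℤ.+ + k                       ≡⟨ ℤP.pos-+ h k ⟨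
    + (h + k)                         ∎)
    where
    open ≡-Reasoning
    [x+y]+[z-y]≡x+z : ∀ x y z → (x ℤ.+ y) ℤ.+ (z - y) ≡ x ℤ.+ z
    [x+y]+[z-y]≡x+z = solve-∀

  deficits-≤ : ∀ {m} {as : Vec ℤ m} → StepsIn[k-Δ,k] as → ∀ t → deficits as t ≤ Δ
  deficits-≤                 _                  zero          = z≤n
  deficits-≤ {as = []}       _                  (suc _)       = z≤n
  deficits-≤ {as = _ ∷ _}    ((lo≤a , a≤k) , _) (suc zero)    = deficit-≤ lo≤a a≤k
  deficits-≤ {as = _ ∷ _}    (_ , steps)        (suc (suc t)) = deficits-≤ steps (suc t)

  deficits-∑ : ∀ {m} (as : Vec ℤ m) h → StepsIn[k-Δ,k] as → NonnegFrom (+ h) as →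
               ∀ t → ∑ t (deficits as) ≤ h + k * t
  deficits-∑ []       h _ _ t = subst (_≤ h + k * t) (sym (∑-zero t λ { (suc _) _ → refl })) z≤n
  deficits-∑ (a ∷ as) h _ _ zero = z≤n
  deficits-∑ (a ∷ as) h ((_ , a≤k) , steps) (0≤h+a , nonneg) (suc t) = begin
    ∑ (suc t) (deficits (a ∷ as))            ≡⟨ ∑-shiftˡ t (deficits (a ∷ as)) ⟩
    deficit a + ∑ t (λ i → deficits (a ∷ as) (suc i))
                                             ≡⟨ cong (λ x → deficit a + x) (∑-cong t λ { (suc _) _ → refl }) ⟩
    deficit a + ∑ t (deficits as)            ≤⟨ +-monoʳ-≤ (deficit a) (deficits-∑ as h′ steps nonneg′ t) ⟩
    deficit a + (h′ + k * t)                 ≡⟨ +-assoc (deficit a) h′ (k * t) ⟨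
    deficit a + h′ + k * t                   ≡⟨ cong (_+ k * t) (trans (+-comm (deficit a) h′) (height+deficit 0≤h+a a≤k)) ⟩
    h + k + k * t                            ≡⟨ +-assoc h k (k * t) ⟩
    h + (k + k * t)                          ≡⟨ cong (λ x → h + x) (*-suc k t) ⟨
    h + k * suc t                            ∎
    where
    open ≤-Reasoning
    h′ = ∣ + h ℤ.+ a ∣
    nonneg′ : NonnegFrom (+ h′) as
    nonneg′ = subst (λ x → NonnegFrom x as) (sym (ℤP.0≤i⇒+∣i∣≡i 0≤h+a)) nonneg

  deficits-injective : ∀ {m} {as bs : Vec ℤ m} → StepsIn[k-Δ,k] as → StepsIn[k-Δ,k] bs →
                       (∀ t → t < m → deficits as (suc t) ≡ deficits bs (suc t)) → as ≡ bs
  deficits-injective {as = []}     {[]}     _ _ _ = refl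
  deficits-injective {as = a ∷ as} {b ∷ bs} ((_ , a≤k) , steps-as) ((_ , b≤k) , steps-bs) same =
    cong₂ _∷_ (deficit-injective a≤k b≤k (same 0 (s≤s z≤n)))
              (deficits-injective steps-as steps-bs λ t t<m → same (suc t) (s≤s t<m))

  -- Δ zeros (truncated subtraction hits deficits as 0 = 0), then the deficits of the steps.
  padded : ∀ {m} → Vec ℤ m → ℕ → ℕ
  padded as j = deficits as (j ∸ Δ)

  padded-shift : ∀ {m} (as : Vec ℤ m) t → padded as (suc (Δ + t)) ≡ deficits as (suc t)
  padded-shift as t = cong (deficits as) (trans (cong (_∸ Δ) (sym (+-suc Δ t))) (m+n∸m≡n Δ (suc t)))

  padded-prefixBounded : ∀ {m} n (as : Vec ℤ m) → StepsIn[k-Δ,k] as → NonnegFrom (+ 0) as →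
                         PrefixBounded k n (padded as)
  padded-prefixBounded n as steps nonneg j _ rewrite ∑-delay Δ (deficits as) refl j with Δ ≤? j
  ... | yes Δ≤j rewrite +-∸-assoc 1 Δ≤j = begin
    k * deficits as (suc (j ∸ Δ)) + ∑ (j ∸ Δ) (deficits as)
      ≤⟨ +-mono-≤ (*-monoʳ-≤ k (deficits-≤ steps (suc (j ∸ Δ)))) (deficits-∑ as 0 steps nonneg (j ∸ Δ)) ⟩
    k * Δ + k * (j ∸ Δ)   ≡⟨ *-distribˡ-+ k Δ (j ∸ Δ) ⟨
    k * (Δ + (j ∸ Δ))     ≡⟨ cong (k *_) (m+[n∸m]≡n Δ≤j) ⟩
    k * j                 ≤⟨ *-monoʳ-≤ k (n≤1+n j) ⟩
    k * suc j             ∎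
    where open ≤-Reasoning
  ... | no Δ≰j rewrite m≤n⇒m∸n≡0 (≰⇒> Δ≰j) | m≤n⇒m∸n≡0 (<⇒≤ (≰⇒> Δ≰j)) | *-zeroʳ k = z≤n

  walkTuple : ∀ n {m} → Vec ℤ m → Vec ℕ n
  walkTuple n as = tabulate (λ i → padded as (suc (toℕ i)))

  walkTuple-injective : ∀ {n m} {as bs : Vec ℤ m} → Δ + m ≤ n → StepsIn[k-Δ,k] as → StepsIn[k-Δ,k] bs →
                        walkTuple n as ≡ walkTuple n bs → as ≡ bs
  walkTuple-injective {n} {m} {as} {bs} Δ+m≤n steps-as steps-bs same =
    deficits-injective steps-as steps-bs λ t t<m → begin
      deficits as (suc t)                     ≡⟨ entry as t<m ⟨
      lookup (walkTuple n as) (index t<m)     ≡⟨ cong (λ v → lookup v (index t<m)) same ⟩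
      lookup (walkTuple n bs) (index t<m)     ≡⟨ entry bs t<m ⟩
      deficits bs (suc t)                     ∎
    where
    open ≡-Reasoning
    index : ∀ {t} → t < m → Fin n
    index t<m = fromℕ< (<-≤-trans (+-monoʳ-< Δ t<m) Δ+m≤n)
    entry : ∀ cs {t} (t<m : t < m) → lookup (walkTuple n cs) (index t<m) ≡ deficits cs (suc t)
    entry cs {t} t<m = begin
      lookup (walkTuple n cs) (index t<m)     ≡⟨ lookup∘tabulate _ (index t<m) ⟩
      padded cs (suc (toℕ (index t<m)))       ≡⟨ cong (padded cs ∘ suc) (toℕ-fromℕ< _) ⟩
      padded cs (suc (Δ + t))                 ≡⟨ padded-shift cs t ⟩
      deficits cs (suc t)                     ∎

lemma7 : (k n Δ : ℕ) → 1 ≤ k → 1 ≤ n → Δ ≤ n ∸ 1 →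
  Σ (RestrictedWalk (+ k - + Δ) (+ k) (n ∸ 1 ∸ Δ) → Vec ℕ (n ∸ 1)) λ f →
    (∀ w → Valid k n (f w)) ×
    (∀ w w′ → f w ≡ f w′ → proj₁ w ≡ proj₁ w′)
lemma7 k n Δ 1≤k _ Δ≤n-1 = tuple , valid , injective
  where
  instance _ = >-nonZero 1≤k

  tuple : RestrictedWalk (+ k - + Δ) (+ k) (n ∸ 1 ∸ Δ) → Vec ℕ (n ∸ 1)
  tuple (as , _) = walkTuple k Δ (n ∸ 1) as

  valid : ∀ w → Valid k n (tuple w)
  valid (as , steps , nonneg) = prefixBounded⇒valid k n _ (padded-prefixBounded k Δ n as steps nonneg)

  injective : ∀ w w′ → tuple w ≡ tuple w′ → proj₁ w ≡ proj₁ w′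
  injective (_ , steps , _) (_ , steps′ , _) =
    walkTuple-injective k Δ (≤-reflexive (m+[n∸m]≡n Δ≤n-1)) steps steps′
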